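{- Let $q\ge 3$, $n\ge 4$, and $V=\mathbb{F}_q^n$. For every $2$-dimensional subspace $X\subset V$ with $X\notin\mathcal{C}(n,2)_q$ there exist $X_1,X_2\in\mathcal{C}(n,1)_q$ such that $X+X_1$ and $X+X_2$ are distinct elements of $\mathcal{C}(n,3)_q$ and, for each $i\in\{1,2\}$, the set $\mathcal{T}^c(X+X_i)=\mathcal{G}_2(X+X_i)\cap\mathcal{C}(n,2)_q$ is a maximal clique of $\Gamma(n,2)_q$.
   Context: $\mathbb{F}_q$ is the field with $q$ elements, $V=\mathbb{F}_q^n$, $C_i=\{x\in V:x_i=0\}$. $\mathcal{G}_m(V)$ is the set of $m$-dimensional subspaces, $\mathcal{C}(n,m)_q$ is the set of $m$-dimensional subspaces contained in no $C_i$. $\Gamma(n,2)_q$ is the graph on $\mathcal{C}(n,2)_q$ in which two subspaces are joined if their intersection is $1$-dimensional. A clique is maximal if it is not properly contained in another clique. -}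

module Defs where

open import Level using (Level; suc; _⊔_)
open import Data.Nat using (ℕ; zero) renaming (suc to sucℕ)
open import Data.Fin using (Fin) renaming (zero to fzero; suc to fsuc)
open import Data.Product using (Σ; _×_; _,_; ∃)
open import Relation.Binary.PropositionalEquality using (_≡_; _≢_)
open import Relation.Nullary using (¬_)
open import Relation.Unary using (Pred)
open import Algebra.Structures using (IsCommutativeRing)
open import Function.Bundles using (_↔_; _⇔_)

record FiniteField (c : Level) (q : ℕ) : Set (suc c) where
  infixl 7 _*_
  infixl 6 _+_
  field
    Carrier : Set c
    _+_ _*_ : Carrier → Carrier → Carrier
    -_ : Carrier → Carrier
    0# 1# : Carrier
    isCommutativeRing : IsCommutativeRing _≡_ _+_ _*_ -_ 0# 1#
    _⁻¹ : Carrier → Carrier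
    inverseʳ : ∀ x → x ≢ 0# → x * (x ⁻¹) ≡ 1#
    0≢1 : 0# ≢ 1#
    enumeration : Fin q ↔ Carrier

module Geometry {c : Level} {q : ℕ} (F : FiniteField c q) (n : ℕ) where
  open FiniteField F

  V : Set c
  V = Fin n → Carrier

  _≐_ : V → V → Set c
  x ≐ y = ∀ j → x j ≡ y j

  _⊕_ : V → V → V
  (x ⊕ y) j = x j + y j

  lincomb : ∀ {m} → (Fin m → Carrier) → (Fin m → V) → V
  lincomb {zero}   γ b j = 0#
  lincomb {sucℕ m} γ b j = γ fzero * b fzero j + lincomb (λ i → γ (fsuc i)) (λ i → b (fsuc i)) j

  LinIndep : ∀ {m} → (Fin m → V) → Set c
  LinIndep {m} b = ∀ (γ : Fin m → Carrier) → (∀ j → lincomb γ b j ≡ 0#) → ∀ i → γ i ≡ 0#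

  Span : ∀ {m} → (Fin m → V) → Pred V c
  Span {m} b x = Σ (Fin m → Carrier) λ γ → x ≐ lincomb γ b

  HasDim : ℕ → Pred V c → Set c
  HasDim m P = Σ (Fin m → V) λ b → LinIndep b × (∀ x → P x ⇔ Span b x)

  _≈ₛ_ : Pred V c → Pred V c → Set c
  P ≈ₛ Q = ∀ x → P x ⇔ Q x

  _⊆ₛ_ : Pred V c → Pred V c → Set c
  P ⊆ₛ Q = ∀ x → P x → Q x

  _+ₛ_ : Pred V c → Pred V c → Pred V c
  (P +ₛ Q) x = Σ V λ y → Σ V λ z → P y × Q z × x ≐ (y ⊕ z)

  _∩ₛ_ : Pred V c → Pred V c → Pred V c
  (P ∩ₛ Q) x = P x × Q x

  C : Fin n → Pred V c
  C i x = x i ≡ 0#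

  InC : ℕ → Pred V c → Set c
  InC m P = HasDim m P × (∀ i → ¬ (P ⊆ₛ C i))

  Adj : Pred V c → Pred V c → Set c
  Adj P Q = HasDim 1 (P ∩ₛ Q)

  Family : Set (suc c)
  Family = Pred (Pred V c) c

  IsClique : Family → Set (suc c)
  IsClique 𝒦 = (∀ Z → 𝒦 Z → InC 2 Z)
             × (∀ Z W → 𝒦 Z → 𝒦 W → ¬ (Z ≈ₛ W) → Adj Z W)

  IsMaximalClique : Family → Set (suc c)
  IsMaximalClique 𝒦 = IsClique 𝒦
                    × (∀ (𝒦′ : Family) → IsClique 𝒦′ → (∀ Z → 𝒦 Z → 𝒦′ Z) → ∀ Z → 𝒦′ Z → 𝒦 Z)

  Tc : Pred V c → Family
  Tc Y Z = (Z ⊆ₛ Y) × InC 2 Z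

-- Since X ∉ 𝒞(n,2), X lies in a coordinate hyperplane Cᵢ, and as n ≥ 4 some unit vector e_k with
-- k ≠ i is not in X; pick a basis r, x of X with x_k = 0. If neither u nor u + x has a zero coordinate (possible as
-- q ≥ 3), then Y = X + ⟨u⟩ has basis u, r, x and lies in 𝒞(n,3). Two distinct planes of the 3-space Y meet in a
-- line, so 𝒯ᶜ(Y) is a clique. It is maximal: a plane Z adjacent to all of 𝒯ᶜ(Y) meets ⟨u,x⟩, ⟨u,r⟩, ⟨u+x,r⟩ ∈ 𝒯ᶜ(Y)
-- in nonzero vectors, and since ⟨u,x⟩ ∩ ⟨u,r⟩ = ⟨u⟩ while u ∉ ⟨u+x,r⟩, two of these vectors are independent, so
-- Z ⊆ Y. Changing u in coordinate k alone gives a second such u′, and X + ⟨u′⟩ ≠ X + ⟨u⟩, since otherwise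
-- u′ − u, a nonzero multiple of e_k vanishing at i, would lie in (X + ⟨u⟩) ∩ Cᵢ = X.
module Submission where

open import Defs
open import Level using (Level)
open import Data.Nat using (ℕ; _≤_)
open import Data.Product using (Σ; _×_)
open import Relation.Nullary using (¬_)
open import Relation.Unary using (Pred)

open import Algebra.Bundles using (CommutativeRing)
open import Algebra.Structures using (IsCommutativeRing)
open import Algebra.Core using (Op₁; Op₂)
import Algebra.Solver.Ring.AlmostCommutativeRing as ACR
import Algebra.Properties.Ring as RingProperties
import Algebra.Properties.Semiring.Mult.TCOptimised as SemiringMult
import Algebra.Properties.CommutativeSemigroup as CommutativeSemigroupProperties
open import Data.Nat as ℕ using (zero; suc; s≤s; z≤n)
import Data.Nat.Properties as ℕ
open import Data.Integer as ℤ using (ℤ; -[1+_]; _⊖_; _◃_)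
import Data.Integer.Properties as ℤ
import Data.Sign as Sign
open import Data.Fin as Fin using (Fin; punchIn; finToFun; funToFin) renaming (zero to fzero; suc to fsuc)
import Data.Fin.Properties as Fin
open import Data.Vec.Functional using ([]; _∷_; tail; updateAt)
open import Data.Vec.Functional.Properties using (updateAt-updates; updateAt-minimal)
open import Data.Maybe using (Maybe; just; nothing)
open import Data.Product using (_,_; proj₁; proj₂; ∃; ∃₂; ∃-syntax)
open import Data.Sum using (_⊎_; inj₁; inj₂)
open import Function.Base using (id; _∘_; const)
open import Function.Bundles using (Inverse; _⇔_; mk⇔; Equivalence)
open import Function.Definitions using (Injective)
open import Relation.Binary.PropositionalEquality
open import Relation.Binary.Definitions using (DecidableEquality)
open import Relation.Nullary using (Dec; yes; no; map′; contradiction)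
open import Relation.Unary using (Decidable)

injection-avoiding : ∀ {m n} (i : Fin (suc n)) → m ≤ n →
                     Σ (Fin m → Fin (suc n)) λ f → Injective _≡_ _≡_ f × ∀ l → f l ≢ i
injection-avoiding i m≤n =
  (λ l → punchIn i (Fin.inject≤ l m≤n)) ,
  (λ eq → Fin.inject≤-injective m≤n m≤n _ _ (Fin.punchIn-injective i _ _ eq)) ,
  (λ l → Fin.punchInᵢ≢i i (Fin.inject≤ l m≤n))

-- Integer coefficients let the normaliser cancel terms such as a − a, which it cannot do with coefficients taken
-- from an abstract ring.
module ℤ-CoefficientSolver
  {c : Level} {A : Set c} {add mul : Op₂ A} {neg : Op₁ A} {o i : A}
  (isCommutativeRing : IsCommutativeRing _≡_ add mul neg o i) where

  private
    R : CommutativeRing c c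
    R = record { isCommutativeRing = isCommutativeRing }

    open CommutativeRing R
      using (_+_; _*_; -_; 0#; 1#; ring; semiring; +-commutativeSemigroup; +-comm; -‿inverseʳ; +-identityˡ; +-identityʳ)
    open RingProperties ring using (-0#≈0#; -‿involutive; -‿+-comm; -‿distribˡ-*; -‿distribʳ-*)
    open SemiringMult semiring using (×-homo-+; ×1-homo-*) renaming (_×_ to _·_)
    open CommutativeSemigroupProperties +-commutativeSemigroup using (interchange)
    open ≡-Reasoning

    ⟦_⟧ : ℤ → A
    ⟦ ℤ.+ n ⟧ = n · 1#
    ⟦ -[1+ n ] ⟧ = - (suc n · 1#)

    ⊖-homo : ∀ m n → ⟦ m ⊖ n ⟧ ≡ m · 1# + - (n · 1#)
    ⊖-homo zero zero = sym (trans (+-identityˡ (- 0#)) -0#≈0#)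
    ⊖-homo zero (suc n) = sym (+-identityˡ _)
    ⊖-homo (suc m) zero = sym (trans (cong ((suc m · 1#) +_) -0#≈0#) (+-identityʳ _))
    ⊖-homo (suc m) (suc n) = begin
      ⟦ suc m ⊖ suc n ⟧                              ≡⟨ cong ⟦_⟧ (ℤ.[1+m]⊖[1+n]≡m⊖n m n) ⟩
      ⟦ m ⊖ n ⟧                                      ≡⟨ ⊖-homo m n ⟩
      m · 1# + - (n · 1#)                            ≡⟨ sym (+-identityˡ _) ⟩
      0# + (m · 1# + - (n · 1#))                     ≡⟨ cong (_+ (m · 1# + - (n · 1#))) (sym (-‿inverseʳ 1#)) ⟩
      (1# + - 1#) + (m · 1# + - (n · 1#))            ≡⟨ interchange 1# (- 1#) (m · 1#) (- (n · 1#)) ⟩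
      (1# + m · 1#) + (- 1# + - (n · 1#))            ≡⟨ cong ((1# + m · 1#) +_) (-‿+-comm 1# (n · 1#)) ⟩
      (1# + m · 1#) + - (1# + n · 1#)
        ≡⟨ sym (cong₂ (λ a b → a + - b) (×-homo-+ 1# 1 m) (×-homo-+ 1# 1 n)) ⟩
      suc m · 1# + - (suc n · 1#)                    ∎

    +-homo : ∀ i j → ⟦ i ℤ.+ j ⟧ ≡ ⟦ i ⟧ + ⟦ j ⟧
    +-homo (ℤ.+ m) (ℤ.+ n) = ×-homo-+ 1# m n
    +-homo (ℤ.+ m) -[1+ n ] = ⊖-homo m (suc n)
    +-homo -[1+ m ] (ℤ.+ n) = trans (⊖-homo n (suc m)) (+-comm _ _)
    +-homo -[1+ m ] -[1+ n ] = begin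
      - (suc (suc (m ℕ.+ n)) · 1#)         ≡⟨ cong (λ k → - (suc k · 1#)) (sym (ℕ.+-suc m n)) ⟩
      - ((suc m ℕ.+ suc n) · 1#)           ≡⟨ cong -_ (×-homo-+ 1# (suc m) (suc n)) ⟩
      - (suc m · 1# + suc n · 1#)          ≡⟨ sym (-‿+-comm _ _) ⟩
      - (suc m · 1#) + - (suc n · 1#)      ∎

    -‿homo : ∀ i → ⟦ ℤ.- i ⟧ ≡ - ⟦ i ⟧
    -‿homo (ℤ.+ zero) = sym -0#≈0#
    -‿homo (ℤ.+ suc n) = refl
    -‿homo -[1+ n ] = sym (-‿involutive _)

    +◃-homo : ∀ k → ⟦ Sign.+ ◃ k ⟧ ≡ k · 1#
    +◃-homo zero = refl
    +◃-homo (suc k) = refl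

    -◃-homo : ∀ k → ⟦ Sign.- ◃ k ⟧ ≡ - (k · 1#)
    -◃-homo zero = sym -0#≈0#
    -◃-homo (suc k) = refl

    *-homo : ∀ i j → ⟦ i ℤ.* j ⟧ ≡ ⟦ i ⟧ * ⟦ j ⟧
    *-homo (ℤ.+ m) (ℤ.+ n) = trans (+◃-homo (m ℕ.* n)) (×1-homo-* m n)
    *-homo (ℤ.+ m) -[1+ n ] = begin
      ⟦ Sign.- ◃ (m ℕ.* suc n) ⟧        ≡⟨ -◃-homo (m ℕ.* suc n) ⟩
      - ((m ℕ.* suc n) · 1#)            ≡⟨ cong -_ (×1-homo-* m (suc n)) ⟩
      - (m · 1# * (suc n · 1#))         ≡⟨ -‿distribʳ-* _ _ ⟩
      m · 1# * - (suc n · 1#)           ∎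
    *-homo -[1+ m ] (ℤ.+ n) = begin
      ⟦ Sign.- ◃ (suc m ℕ.* n) ⟧        ≡⟨ -◃-homo (suc m ℕ.* n) ⟩
      - ((suc m ℕ.* n) · 1#)            ≡⟨ cong -_ (×1-homo-* (suc m) n) ⟩
      - (suc m · 1# * (n · 1#))         ≡⟨ -‿distribˡ-* _ _ ⟩
      - (suc m · 1#) * (n · 1#)         ∎
    *-homo -[1+ m ] -[1+ n ] = begin
      (suc m ℕ.* suc n) · 1#                   ≡⟨ ×1-homo-* (suc m) (suc n) ⟩
      suc m · 1# * (suc n · 1#)                ≡⟨ sym (-‿involutive _) ⟩
      - - (suc m · 1# * (suc n · 1#))          ≡⟨ cong -_ (-‿distribˡ-* _ _) ⟩
      - (- (suc m · 1#) * (suc n · 1#))        ≡⟨ -‿distribʳ-* _ _ ⟩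
      - (suc m · 1#) * - (suc n · 1#)          ∎

    morphism : ℤ.+-*-rawRing ACR.-Raw-AlmostCommutative⟶ ACR.fromCommutativeRing R
    morphism = record
      { ⟦_⟧ = ⟦_⟧ ; +-homo = +-homo ; *-homo = *-homo ; -‿homo = -‿homo ; 0-homo = refl ; 1-homo = refl }

    coeff≟ : ∀ i j → Maybe (⟦ i ⟧ ≡ ⟦ j ⟧)
    coeff≟ i j with i ℤ.≟ j
    ... | yes refl = just refl
    ... | no _ = nothing

  open import Algebra.Solver.Ring ℤ.+-*-rawRing (ACR.fromCommutativeRing R) morphism coeff≟ public
    using (solve; _:=_; _:+_; _:*_; :-_; _:-_; con)


module FieldProperties {c : Level} {q : ℕ} (F : FiniteField c q) where
  open FiniteField F
  open Inverse enumeration using (to; from; strictlyInverseˡ; strictlyInverseʳ)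

  commutativeRing : CommutativeRing c c
  commutativeRing = record { isCommutativeRing = isCommutativeRing }

  open CommutativeRing commutativeRing public
    using (*-comm; +-identityˡ; +-identityʳ; *-identityˡ; zeroˡ; zeroʳ; -‿inverseʳ)
  open RingProperties (CommutativeRing.ring commutativeRing) public
    using (x∙y⁻¹≈ε⇒x≈y; x≈y⇒x∙y⁻¹≈ε; -1*x≈-x; +-inverseˡ-unique)
  open ℤ-CoefficientSolver isCommutativeRing public
  open ≡-Reasoning

  from-injective : ∀ {a b} → from a ≡ from b → a ≡ b
  from-injective {a} {b} eq = trans (sym (strictlyInverseˡ a)) (trans (cong to eq) (strictlyInverseˡ b))

  to-injective : ∀ {i j} → to i ≡ to j → i ≡ j
  to-injective {i} {j} eq = trans (sym (strictlyInverseʳ i)) (trans (cong from eq) (strictlyInverseʳ j))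

  _≟_ : DecidableEquality Carrier
  a ≟ b = map′ from-injective (cong from) (from a Fin.≟ from b)

  1≢0 : 1# ≢ 0#
  1≢0 = 0≢1 ∘ sym

  ⁻¹*-cancel : ∀ {a} → a ≢ 0# → ∀ b → a ⁻¹ * (a * b) ≡ b
  ⁻¹*-cancel {a} a≢0 b = begin
    a ⁻¹ * (a * b)  ≡⟨ solve 3 (λ a a⁻¹ b → a⁻¹ :* (a :* b) := (a :* a⁻¹) :* b) refl a (a ⁻¹) b ⟩
    (a * a ⁻¹) * b  ≡⟨ cong (_* b) (inverseʳ a a≢0) ⟩
    1# * b          ≡⟨ *-identityˡ b ⟩
    b               ∎

  *-cancel-≢0ˡ : ∀ {a b} → a ≢ 0# → a * b ≡ 0# → b ≡ 0#
  *-cancel-≢0ˡ {a} {b} a≢0 ab≡0 = trans (sym (⁻¹*-cancel a≢0 b)) (trans (cong (a ⁻¹ *_) ab≡0) (zeroʳ _))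

  *-cancel-≢0ʳ : ∀ {a b} → b ≢ 0# → a * b ≡ 0# → a ≡ 0#
  *-cancel-≢0ʳ {a} {b} b≢0 ab≡0 = *-cancel-≢0ˡ b≢0 (trans (*-comm b a) ab≡0)

  element : ∀ m → m ℕ.< q → Carrier
  element m m<q = to (Fin.fromℕ< m<q)

  element-injective : ∀ {m m′} (p : m ℕ.< q) (p′ : m′ ℕ.< q) → element m p ≡ element m′ p′ → m ≡ m′
  element-injective p p′ eq =
    trans (sym (Fin.toℕ-fromℕ< p)) (trans (cong Fin.toℕ (to-injective eq)) (Fin.toℕ-fromℕ< p′))

  2≤q : 2 ≤ q
  2≤q = distinct-elements (from 0#) (from 1#) (0≢1 ∘ from-injective)
    where
      distinct-elements : ∀ {m} (i j : Fin m) → i ≢ j → 2 ≤ m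
      distinct-elements {suc (suc m)} _ _ _ = s≤s (s≤s z≤n)
      distinct-elements {suc zero} fzero fzero i≢j = contradiction refl i≢j

  module _ (3≤q : 3 ≤ q) where
    private
      0<q : 0 ℕ.< q
      0<q = ℕ.≤-trans (s≤s z≤n) 3≤q
      1<q : 1 ℕ.< q
      1<q = ℕ.≤-trans (s≤s (s≤s z≤n)) 3≤q

      t₀ t₁ t₂ : Carrier
      t₀ = element 0 0<q
      t₁ = element 1 1<q
      t₂ = element 2 3≤q

      t₀≢t₁ : t₀ ≢ t₁
      t₀≢t₁ eq with () ← element-injective 0<q 1<q eq
      t₀≢t₂ : t₀ ≢ t₂
      t₀≢t₂ eq with () ← element-injective 0<q 3≤q eq
      t₁≢t₂ : t₁ ≢ t₂
      t₁≢t₂ eq with () ← element-injective 1<q 3≤q eq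

      avoiding-other : ∀ a b → t₀ ≡ a → ∃[ t ] t ≢ a × t ≢ b
      avoiding-other a b t₀≡a with t₁ ≟ b
      ... | no t₁≢b = t₁ , (λ t₁≡a → t₀≢t₁ (trans t₀≡a (sym t₁≡a))) , t₁≢b
      ... | yes t₁≡b = t₂ , (λ t₂≡a → t₀≢t₂ (trans t₀≡a (sym t₂≡a))) , (λ t₂≡b → t₁≢t₂ (trans t₁≡b (sym t₂≡b)))

    ∃-avoiding : ∀ a b → ∃[ t ] t ≢ a × t ≢ b
    ∃-avoiding a b with t₀ ≟ a | t₀ ≟ b
    ... | yes t₀≡a | _ = avoiding-other a b t₀≡a
    ... | no _ | yes t₀≡b = let t , t≢b , t≢a = avoiding-other b a t₀≡b in t , t≢a , t≢b
    ... | no t₀≢a | no t₀≢b = t₀ , t₀≢a , t₀≢b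

  linear-root : ∀ {a x y} → a ≢ 0# → a * x + y ≡ 0# → x ≡ - (a ⁻¹) * y
  linear-root {a} {x} {y} a≢0 ax+y≡0 = begin
    x
      ≡⟨ sym (⁻¹*-cancel a≢0 x) ⟩
    a ⁻¹ * (a * x)
      ≡⟨ solve 3 (λ a⁻¹ ax y → a⁻¹ :* ax := a⁻¹ :* (ax :+ y) :- a⁻¹ :* y) refl (a ⁻¹) (a * x) y ⟩
    a ⁻¹ * (a * x + y) + - (a ⁻¹ * y)
      ≡⟨ cong (λ s → a ⁻¹ * s + - (a ⁻¹ * y)) ax+y≡0 ⟩
    a ⁻¹ * 0# + - (a ⁻¹ * y)
      ≡⟨ solve 2 (λ a⁻¹ y → a⁻¹ :* con ℤ.0ℤ :+ :- (a⁻¹ :* y) := :- a⁻¹ :* y) refl (a ⁻¹) y ⟩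
    - (a ⁻¹) * y
      ∎

module LinearAlgebra {c : Level} {q : ℕ} (F : FiniteField c q) (n : ℕ) where
  open FiniteField F
  open FieldProperties F
  open Geometry F n
  open Inverse enumeration using (to; from; strictlyInverseˡ)
  open import Algebra.Properties.Monoid.Sum (CommutativeRing.+-monoid commutativeRing) using (sum)
  open ≡-Reasoning

  lincomb-cong : ∀ {m} {γ δ : Fin m → Carrier} (b : Fin m → V) → (∀ i → γ i ≡ δ i) →
                 ∀ j → lincomb γ b j ≡ lincomb δ b j
  lincomb-cong {zero} b γ≗δ j = refl
  lincomb-cong {suc m} b γ≗δ j = cong₂ _+_ (cong (_* b fzero j) (γ≗δ fzero)) (lincomb-cong (tail b) (γ≗δ ∘ fsuc) j)

  lincomb-zero : ∀ {m} (b : Fin m → V) j → lincomb (λ _ → 0#) b j ≡ 0#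
  lincomb-zero {zero} b j = refl
  lincomb-zero {suc m} b j = begin
    0# * b fzero j + lincomb (λ _ → 0#) (tail b) j  ≡⟨ cong₂ _+_ (zeroˡ _) (lincomb-zero (tail b) j) ⟩
    0# + 0#                                        ≡⟨ +-identityʳ 0# ⟩
    0#                                             ∎

  lincomb-vanishing : ∀ {m} (γ : Fin m → Carrier) {b : Fin m → V} {j} → (∀ i → b i j ≡ 0#) → lincomb γ b j ≡ 0#
  lincomb-vanishing {zero} γ bj≡0 = refl
  lincomb-vanishing {suc m} γ {b} {j} bj≡0 = begin
    γ fzero * b fzero j + lincomb (tail γ) (tail b) j
      ≡⟨ cong₂ _+_ (cong (γ fzero *_) (bj≡0 fzero)) (lincomb-vanishing (tail γ) (bj≡0 ∘ fsuc)) ⟩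
    γ fzero * 0# + 0#
      ≡⟨ trans (+-identityʳ _) (zeroʳ _) ⟩
    0#
      ∎

  lincomb-+ : ∀ {m} (γ δ : Fin m → Carrier) (b : Fin m → V) j →
              lincomb (λ i → γ i + δ i) b j ≡ lincomb γ b j + lincomb δ b j
  lincomb-+ {zero} γ δ b j = sym (+-identityʳ 0#)
  lincomb-+ {suc m} γ δ b j = begin
    (γ fzero + δ fzero) * b fzero j + lincomb (λ i → γ (fsuc i) + δ (fsuc i)) (tail b) j
      ≡⟨ cong (_ +_) (lincomb-+ (tail γ) (tail δ) (tail b) j) ⟩
    (γ fzero + δ fzero) * b fzero j + (lincomb (tail γ) (tail b) j + lincomb (tail δ) (tail b) j)
      ≡⟨ solve 5 (λ g d x A B → (g :+ d) :* x :+ (A :+ B) := (g :* x :+ A) :+ (d :* x :+ B)) refl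
           (γ fzero) (δ fzero) (b fzero j) _ _ ⟩
    lincomb γ b j + lincomb δ b j
      ∎

  lincomb-* : ∀ {m} a (γ : Fin m → Carrier) (b : Fin m → V) j → lincomb (λ i → a * γ i) b j ≡ a * lincomb γ b j
  lincomb-* {zero} a γ b j = sym (zeroʳ a)
  lincomb-* {suc m} a γ b j = begin
    (a * γ fzero) * b fzero j + lincomb (λ i → a * γ (fsuc i)) (tail b) j
      ≡⟨ cong (_ +_) (lincomb-* a (tail γ) (tail b) j) ⟩
    (a * γ fzero) * b fzero j + a * lincomb (tail γ) (tail b) j
      ≡⟨ solve 4 (λ a g x A → (a :* g) :* x :+ a :* A := a :* (g :* x :+ A)) refl a (γ fzero) (b fzero j) _ ⟩
    a * lincomb γ b j
      ∎

  lincomb-neg : ∀ {m} (γ : Fin m → Carrier) (b : Fin m → V) j → lincomb (λ i → - γ i) b j ≡ - lincomb γ b j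
  lincomb-neg γ b j = begin
    lincomb (λ i → - γ i) b j       ≡⟨ lincomb-cong b (λ i → sym (-1*x≈-x (γ i))) j ⟩
    lincomb (λ i → - 1# * γ i) b j  ≡⟨ lincomb-* (- 1#) γ b j ⟩
    - 1# * lincomb γ b j            ≡⟨ -1*x≈-x _ ⟩
    - lincomb γ b j                 ∎

  lincomb-- : ∀ {m} (γ δ : Fin m → Carrier) (b : Fin m → V) j →
              lincomb (λ i → γ i + - δ i) b j ≡ lincomb γ b j + - lincomb δ b j
  lincomb-- γ δ b j = trans (lincomb-+ γ (λ i → - δ i) b j) (cong (lincomb γ b j +_) (lincomb-neg δ b j))

  compose : ∀ {m k} → (Fin m → Carrier) → (Fin m → Fin k → Carrier) → Fin k → Carrier
  compose γ β i = sum (λ l → γ l * β l i)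

  lincomb-compose : ∀ {m k} (γ : Fin m → Carrier) (β : Fin m → Fin k → Carrier) (b : Fin k → V) {a : Fin m → V} →
                    (∀ l j → a l j ≡ lincomb (β l) b j) → ∀ j → lincomb γ a j ≡ lincomb (compose γ β) b j
  lincomb-compose {zero} γ β b a≡βb j = sym (lincomb-zero b j)
  lincomb-compose {suc m} γ β b {a} a≡βb j = begin
    γ fzero * a fzero j + lincomb (tail γ) (tail a) j
      ≡⟨ cong₂ _+_ (cong (γ fzero *_) (a≡βb fzero j)) (lincomb-compose (tail γ) (tail β) b (a≡βb ∘ fsuc) j) ⟩
    γ fzero * lincomb (β fzero) b j + lincomb (compose (tail γ) (tail β)) b j
      ≡⟨ cong (_+ lincomb (compose (tail γ) (tail β)) b j) (sym (lincomb-* (γ fzero) (β fzero) b j)) ⟩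
    lincomb (λ i → γ fzero * β fzero i) b j + lincomb (compose (tail γ) (tail β)) b j
      ≡⟨ sym (lincomb-+ _ _ b j) ⟩
    lincomb (compose γ β) b j
      ∎

  _≐?_ : (x y : V) → Dec (x ≐ y)
  x ≐? y = Fin.all? (λ j → x j ≟ y j)

  Nonzero : V → Set c
  Nonzero v = ∃ λ j → v j ≢ 0#

  ¬≐0⇒Nonzero : ∀ {v} → ¬ (∀ j → v j ≡ 0#) → Nonzero v
  ¬≐0⇒Nonzero {v} = Fin.¬∀⟶∃¬ n _ (λ j → v j ≟ 0#)

  Span-resp : ∀ {m} {b : Fin m → V} {x y} → Span b x → x ≐ y → Span b y
  Span-resp (γ , x≐γb) x≐y = γ , λ j → trans (sym (x≐y j)) (x≐γb j)

  Span-member : ∀ {m} (b : Fin m → V) l → Span b (b l)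
  Span-member b fzero = (1# ∷ λ _ → 0#) , λ j → sym (begin
    1# * b fzero j + lincomb (λ _ → 0#) (tail b) j  ≡⟨ cong₂ _+_ (*-identityˡ _) (lincomb-zero (tail b) j) ⟩
    b fzero j + 0#                                 ≡⟨ +-identityʳ _ ⟩
    b fzero j                                      ∎)
  Span-member b (fsuc l) with γ , b≐γb ← Span-member (tail b) l =
    (0# ∷ γ) , λ j → trans (b≐γb j) (sym (trans (cong (_+ lincomb γ (tail b) j) (zeroˡ _)) (+-identityˡ _)))

  Span-⊆ : ∀ {m k} {a : Fin m → V} {b : Fin k → V} → (∀ l → Span b (a l)) → ∀ {x} → Span a x → Span b x
  Span-⊆ {b = b} a⊆b (γ , x≐γa) =
    compose γ (proj₁ ∘ a⊆b) , λ j → trans (x≐γa j) (lincomb-compose γ (proj₁ ∘ a⊆b) b (proj₂ ∘ a⊆b) j)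

  Span-vanishing : ∀ {m} {a : Fin m → V} {v} i → (∀ l → a l i ≡ 0#) → Span a v → v i ≡ 0#
  Span-vanishing i ai≡0 (γ , v≐γa) = trans (v≐γa i) (lincomb-vanishing γ ai≡0)

  coefficients : ∀ {m} → Fin (q ℕ.^ m) → Fin m → Carrier
  coefficients k = to ∘ finToFun k

  coefficients-funToFin : ∀ {m} (γ : Fin m → Carrier) i → coefficients (funToFin (from ∘ γ)) i ≡ γ i
  coefficients-funToFin γ i = trans (cong to (Fin.finToFun-funToFin (from ∘ γ) i)) (strictlyInverseˡ (γ i))

  Span? : ∀ {m} (b : Fin m → V) → Decidable (Span b)
  Span? b x = map′ (λ (k , x≐) → coefficients k , x≐) (λ (γ , x≐γb) → funToFin (from ∘ γ) , λ j →
                trans (x≐γb j) (lincomb-cong b (sym ∘ coefficients-funToFin γ) j))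
              (Fin.any? (λ k → x ≐? lincomb (coefficients k) b))

  module _ {m} {P : Pred V c} (dP : HasDim m P) where
    private
      basis = proj₁ dP

    ∈⇒Span : ∀ {x} → P x → Span basis x
    ∈⇒Span {x} = Equivalence.to (proj₂ (proj₂ dP) x)

    Span⇒∈ : ∀ {x} → Span basis x → P x
    Span⇒∈ {x} = Equivalence.from (proj₂ (proj₂ dP) x)

    basis-∈ : ∀ l → P (basis l)
    basis-∈ l = Span⇒∈ (Span-member basis l)

    Span-closed : ∀ {k} {a : Fin k → V} → (∀ l → P (a l)) → ∀ {x} → Span a x → P x
    Span-closed a∈P x∈⟨a⟩ = Span⇒∈ (Span-⊆ (∈⇒Span ∘ a∈P) x∈⟨a⟩)

    ∈-resp : ∀ {x y} → P x → x ≐ y → P y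
    ∈-resp x∈P x≐y = Span⇒∈ (Span-resp (∈⇒Span x∈P) x≐y)

    ∈? : Decidable P
    ∈? x = map′ Span⇒∈ ∈⇒Span (Span? basis x)

  Dependent : ∀ {m} → (Fin m → V) → Set c
  Dependent {m} a = Σ (Fin m → Carrier) λ γ → (∃ λ l → γ l ≢ 0#) × (∀ j → lincomb γ a j ≡ 0#)

  LinIndep⇒¬Dependent : ∀ {m} {a : Fin m → V} → LinIndep a → ¬ Dependent a
  LinIndep⇒¬Dependent ia (γ , (l , γl≢0) , γa≡0) = γl≢0 (ia γ γa≡0 l)

  private
    funToFin-cong : ∀ {m k} {f g : Fin m → Fin k} → (∀ l → f l ≡ g l) → funToFin f ≡ funToFin g
    funToFin-cong {zero} f≗g = refl
    funToFin-cong {suc m} f≗g = cong₂ Fin.combine (f≗g fzero) (funToFin-cong (f≗g ∘ fsuc))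

    coefficients-≢ : ∀ {m} {k k′ : Fin (q ℕ.^ m)} → k ≢ k′ → ∃ λ l → coefficients k l ≢ coefficients k′ l
    coefficients-≢ {m} {k} {k′} k≢k′ = Fin.¬∀⟶∃¬ m _ (λ l → coefficients k l ≟ coefficients k′ l) λ k≗k′ →
      k≢k′ (begin
        k                               ≡⟨ sym (Fin.funToFin-finToFin {m} {q} k) ⟩
        funToFin {m} {q} (finToFun k)   ≡⟨ funToFin-cong (to-injective ∘ k≗k′) ⟩
        funToFin {m} {q} (finToFun k′)  ≡⟨ Fin.funToFin-finToFin {m} {q} k′ ⟩
        k′                      ∎)

  -- Pigeonhole: there are q^(m+1) coefficient vectors for a but only q^m for b.
  dependent : ∀ {m} (a : Fin (suc m) → V) (b : Fin m → V) → (∀ l → Span b (a l)) → Dependent a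
  dependent {m} a b a⊆b = dependence-of-collision (Fin.pigeonhole (ℕ.^-monoʳ-< q 2≤q (ℕ.n<1+n m)) image)
    where
      β = proj₁ ∘ a⊆b

      image : Fin (q ℕ.^ suc m) → Fin (q ℕ.^ m)
      image k = funToFin (from ∘ compose (coefficients k) β)

      dependence-of-collision : (∃₂ λ k k′ → k Fin.< k′ × image k ≡ image k′) → Dependent a
      dependence-of-collision (k , k′ , k<k′ , same-image) = γ , nontrivial , relation
        where
          same-compose : ∀ i → compose (coefficients k) β i ≡ compose (coefficients k′) β i
          same-compose i = from-injective (begin
            from (compose (coefficients k) β i)
              ≡⟨ sym (Fin.finToFun-funToFin (from ∘ compose (coefficients k) β) i) ⟩
            finToFun (image k) i
              ≡⟨ cong (λ t → finToFun t i) same-image ⟩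
            finToFun (image k′) i
              ≡⟨ Fin.finToFun-funToFin (from ∘ compose (coefficients k′) β) i ⟩
            from (compose (coefficients k′) β i)
              ∎)

          γ : Fin (suc m) → Carrier
          γ i = coefficients k i + - coefficients k′ i

          nontrivial : ∃ λ l → γ l ≢ 0#
          nontrivial = let l , differ = coefficients-≢ {suc m} (Fin.<⇒≢ k<k′) in l , differ ∘ x∙y⁻¹≈ε⇒x≈y _ _

          relation : ∀ j → lincomb γ a j ≡ 0#
          relation j = begin
            lincomb γ a j
              ≡⟨ lincomb-- (coefficients k) (coefficients k′) a j ⟩
            lincomb (coefficients k) a j + - lincomb (coefficients k′) a j
              ≡⟨ cong₂ (λ s t → s + - t) (lincomb-compose (coefficients k) β b (proj₂ ∘ a⊆b) j)
                                         (lincomb-compose (coefficients k′) β b (proj₂ ∘ a⊆b) j) ⟩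
            lincomb (compose (coefficients k) β) b j + - lincomb (compose (coefficients k′) β) b j
              ≡⟨ x≈y⇒x∙y⁻¹≈ε (lincomb-cong b same-compose j) ⟩
            0#
              ∎

  ¬LinIndep-in-Span : ∀ {m} {a : Fin (suc m) → V} {b : Fin m → V} → (∀ l → Span b (a l)) → ¬ LinIndep a
  ¬LinIndep-in-Span {a = a} {b} a⊆b ia = LinIndep⇒¬Dependent {a = a} ia (dependent a b a⊆b)

  LinIndep-tail : ∀ {m} {a : Fin (suc m) → V} → LinIndep a → LinIndep (tail a)
  LinIndep-tail {a = a} ia γ γa≡0 i =
    ia (0# ∷ γ) (λ j → trans (cong (_+ lincomb γ (tail a) j) (zeroˡ _)) (trans (+-identityˡ _) (γa≡0 j))) (fsuc i)

  LinIndep⇒Nonzero : ∀ {m} {a : Fin m → V} → LinIndep a → ∀ l → Nonzero (a l)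
  LinIndep⇒Nonzero {a = a} ia fzero = ¬≐0⇒Nonzero λ a₀≐0 → 1≢0 (ia (1# ∷ λ _ → 0#) (λ j → begin
    1# * a fzero j + lincomb (λ _ → 0#) (tail a) j
      ≡⟨ cong₂ _+_ (trans (*-identityˡ _) (a₀≐0 j)) (lincomb-zero (tail a) j) ⟩
    0# + 0#
      ≡⟨ +-identityʳ 0# ⟩
    0#
      ∎) fzero)
  LinIndep⇒Nonzero {a = a} ia (fsuc l) = LinIndep⇒Nonzero (LinIndep-tail {a = a} ia) l

  relation-tail : ∀ {m} {γ : Fin (suc m) → Carrier} {a : Fin (suc m) → V} {j} →
                  γ fzero ≡ 0# → lincomb γ a j ≡ 0# → lincomb (tail γ) (tail a) j ≡ 0#
  relation-tail {γ = γ} {a} {j} γ₀≡0 γa≡0 = begin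
    lincomb (tail γ) (tail a) j
      ≡⟨ sym (+-identityˡ _) ⟩
    0# + lincomb (tail γ) (tail a) j
      ≡⟨ cong (_+ lincomb (tail γ) (tail a) j) (sym (trans (cong (_* a fzero j) γ₀≡0) (zeroˡ _))) ⟩
    γ fzero * a fzero j + lincomb (tail γ) (tail a) j
      ≡⟨ γa≡0 ⟩
    0#
      ∎

  Span-of-relation : ∀ {m} {γ : Fin (suc m) → Carrier} {a : Fin (suc m) → V} →
                     γ fzero ≢ 0# → (∀ j → lincomb γ a j ≡ 0#) → Span (tail a) (a fzero)
  Span-of-relation {γ = γ} {a} γ₀≢0 γa≡0 = (λ i → - (γ fzero ⁻¹) * γ (fsuc i)) , λ j →
    trans (linear-root γ₀≢0 (γa≡0 j)) (sym (lincomb-* (- (γ fzero ⁻¹)) (tail γ) (tail a) j))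

  ∷-LinIndep : ∀ {m} {a : Fin (suc m) → V} → LinIndep (tail a) → ¬ Span (tail a) (a fzero) → LinIndep a
  ∷-LinIndep {a = a} ia a₀∉ γ γa≡0 with γ fzero ≟ 0#
  ... | no γ₀≢0 = contradiction (Span-of-relation {γ = γ} {a} γ₀≢0 γa≡0) a₀∉
  ... | yes γ₀≡0 = λ { fzero → γ₀≡0 ; (fsuc i) → ia (tail γ) (λ j → relation-tail {γ = γ} {a} γ₀≡0 (γa≡0 j)) i }

  ∷-LinIndep-at : ∀ {m} {a : Fin (suc m) → V} i → LinIndep (tail a) → (∀ l → a (fsuc l) i ≡ 0#) → a fzero i ≢ 0# →
                  LinIndep a
  ∷-LinIndep-at {a = a} i ia ai≡0 a₀i≢0 = ∷-LinIndep {a = a} ia (a₀i≢0 ∘ Span-vanishing {a = tail a} i ai≡0)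

  Dependent⇒Span : ∀ {m} {a : Fin (suc m) → V} → LinIndep (tail a) → Dependent a → Span (tail a) (a fzero)
  Dependent⇒Span {a = a} ia dep with Span? (tail a) (a fzero)
  ... | yes a₀∈ = a₀∈
  ... | no a₀∉ = contradiction dep (LinIndep⇒¬Dependent {a = a} (∷-LinIndep {a = a} ia a₀∉))

  Span-exchange : ∀ {m} {a b : Fin m → V} → LinIndep a → (∀ i → Span b (a i)) → ∀ j → Span a (b j)
  Span-exchange {a = a} {b} ia a⊆b j =
    Dependent⇒Span {a = b j ∷ a} ia (dependent (b j ∷ a) b λ { fzero → Span-member b j ; (fsuc i) → a⊆b i })

  spanned-by-LinIndep : ∀ {m} {P : Pred V c} (dP : HasDim m P) {a : Fin m → V} → LinIndep a → (∀ l → P (a l)) →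
                        ∀ x → P x ⇔ Span a x
  spanned-by-LinIndep dP ia a∈P x =
    mk⇔ (λ x∈P → Span-⊆ (Span-exchange ia (∈⇒Span dP ∘ a∈P)) (∈⇒Span dP x∈P)) (Span-closed dP a∈P)

  line : V → Pred V c
  line v = Span (v ∷ [])

  LinIndep-line : ∀ {v} → Nonzero v → LinIndep (v ∷ [])
  LinIndep-line {v} (j , vj≢0) = ∷-LinIndep {a = v ∷ []} (λ _ _ ()) (λ (_ , v≐0) → vj≢0 (v≐0 j))

  line-sym : ∀ {v w} → Nonzero w → line v w → line w v
  line-sym {v} {w} (j , wj≢0) (γ , w≐γv) = (γ fzero ⁻¹ ∷ []) , λ i → begin
    v i                          ≡⟨ sym (⁻¹*-cancel γ₀≢0 (v i)) ⟩
    γ fzero ⁻¹ * (γ fzero * v i)  ≡⟨ cong (γ fzero ⁻¹ *_) (sym (trans (w≐γv i) (+-identityʳ _))) ⟩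
    γ fzero ⁻¹ * w i              ≡⟨ sym (+-identityʳ _) ⟩
    γ fzero ⁻¹ * w i + 0#         ∎
    where
      γ₀≢0 : γ fzero ≢ 0#
      γ₀≢0 γ₀≡0 = wj≢0 (trans (w≐γv j) (trans (+-identityʳ _) (trans (cong (_* v j) γ₀≡0) (zeroˡ _))))

  line-closed : ∀ {m} {P : Pred V c} (dP : HasDim m P) {v x} → P v → line v x → P x
  line-closed dP {v} v∈P = Span-closed dP {a = v ∷ []} λ { fzero → v∈P }

  pair-∈ : ∀ {P : Pred V c} {v w} → P v → P w → ∀ l → P ((v ∷ w ∷ []) l)
  pair-∈ v∈P w∈P fzero = v∈P
  pair-∈ v∈P w∈P (fsuc fzero) = w∈P

  plane-closed : ∀ {m} {P : Pred V c} (dP : HasDim m P) {v w x} → P v → P w → Span (v ∷ w ∷ []) x → P x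
  plane-closed {P = P} dP {v} {w} v∈P w∈P = Span-closed dP {a = v ∷ w ∷ []} (pair-∈ {P = P} v∈P w∈P)

  plane-⊆-Span : ∀ {Z : Pred V c} → HasDim 2 Z → ∀ {v w} → LinIndep (v ∷ w ∷ []) → Z v → Z w →
                 Z ⊆ₛ Span (v ∷ w ∷ [])
  plane-⊆-Span {Z} dZ {v} {w} i v∈Z w∈Z t =
    Equivalence.to (spanned-by-LinIndep dZ {a = v ∷ w ∷ []} i (pair-∈ {P = Z} v∈Z w∈Z) t)

  +ₛ-line : ∀ {m} {P : Pred V c} {b : Fin m → V} → (∀ x → P x ⇔ Span b x) →
            ∀ v x → (P +ₛ line v) x ⇔ Span (v ∷ b) x
  +ₛ-line {P = P} {b} P⇔ v x = mk⇔ to-Span from-Span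
    where
      shift : ∀ g w L → L + (g * w + 0#) ≡ g * w + L
      shift = solve 3 (λ g w L → L :+ (g :* w :+ con ℤ.0ℤ) := g :* w :+ L) refl

      to-Span : (P +ₛ line v) x → Span (v ∷ b) x
      to-Span (y , z , y∈P , (g , z≐gv) , x≐y+z) with β , y≐βb ← Equivalence.to (P⇔ y) y∈P =
        (g fzero ∷ β) , λ j →
          trans (x≐y+z j) (trans (cong₂ _+_ (y≐βb j) (z≐gv j)) (shift (g fzero) (v j) (lincomb β b j)))

      from-Span : Span (v ∷ b) x → (P +ₛ line v) x
      from-Span (γ , x≐γ) =
        lincomb (tail γ) b , lincomb (γ fzero ∷ []) (v ∷ []) ,
        Equivalence.from (P⇔ _) (tail γ , λ j → refl) , (γ fzero ∷ [] , λ j → refl) ,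
        λ j → trans (x≐γ j) (sym (shift (γ fzero) (v j) (lincomb (tail γ) b j)))

  zero-∈ : ∀ {m} {P : Pred V c} (dP : HasDim m P) → P (λ _ → 0#)
  zero-∈ dP = Span⇒∈ dP ((λ _ → 0#) , λ j → sym (lincomb-zero (proj₁ dP) j))

  difference-∈ : ∀ {m} {P : Pred V c} (dP : HasDim m P) {v w} → P v → P w → P (λ j → v j + - w j)
  difference-∈ dP {v} {w} v∈P w∈P = plane-closed dP v∈P w∈P ((1# ∷ - 1# ∷ []) , λ j →
    solve 2 (λ v w → v :- w := con ℤ.1ℤ :* v :+ (:- con ℤ.1ℤ :* w :+ con ℤ.0ℤ)) refl (v j) (w j))

  LinIndep-swap : ∀ {v w} → LinIndep (v ∷ w ∷ []) → LinIndep (w ∷ v ∷ [])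
  LinIndep-swap {v} {w} i γ γwv≡0 = λ { fzero → swapped (fsuc fzero) ; (fsuc fzero) → swapped fzero }
    where
      swapped : ∀ l → (γ (fsuc fzero) ∷ γ fzero ∷ []) l ≡ 0#
      swapped = i (γ (fsuc fzero) ∷ γ fzero ∷ []) λ j → trans
        (solve 4 (λ a b v w → a :* v :+ (b :* w :+ con ℤ.0ℤ) := b :* w :+ (a :* v :+ con ℤ.0ℤ)) refl
           (γ (fsuc fzero)) (γ fzero) (v j) (w j))
        (γwv≡0 j)

module Cliques {c : Level} {q : ℕ} (F : FiniteField c q) (n : ℕ) where
  open FiniteField F
  open FieldProperties F
  open Geometry F n
  open LinearAlgebra F n
  open ≡-Reasoning

  Meet : Pred V c → Pred V c → Set c
  Meet Z W = Σ V λ v → Z v × W v × Nonzero v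

  planes-containing-LinIndep-pair : ∀ {Z W : Pred V c} → HasDim 2 Z → HasDim 2 W → ∀ {v w} → LinIndep (v ∷ w ∷ []) →
                                    Z v → Z w → W v → W w → Z ≈ₛ W
  planes-containing-LinIndep-pair dZ dW i v∈Z w∈Z v∈W w∈W x =
    mk⇔ (plane-closed dW v∈W w∈W ∘ plane-⊆-Span dZ i v∈Z w∈Z x) (plane-closed dZ v∈Z w∈Z ∘ plane-⊆-Span dW i v∈W w∈W x)

  distinct-planes-meet-in-line : ∀ {Z W : Pred V c} → HasDim 2 Z → HasDim 2 W → ¬ Z ≈ₛ W → Meet Z W → Adj Z W
  distinct-planes-meet-in-line {Z} {W} dZ dW Z≉W (v , v∈Z , v∈W , v≢0) = (v ∷ []) , LinIndep-line v≢0 , λ x →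
    mk⇔ (to-line x) λ x∈⟨v⟩ → line-closed dZ v∈Z x∈⟨v⟩ , line-closed dW v∈W x∈⟨v⟩
    where
      to-line : ∀ x → (Z ∩ₛ W) x → line v x
      to-line x (x∈Z , x∈W) with Span? (v ∷ []) x
      ... | yes x∈⟨v⟩ = x∈⟨v⟩
      ... | no x∉⟨v⟩ = contradiction (planes-containing-LinIndep-pair dZ dW xv-indep x∈Z v∈Z x∈W v∈W) Z≉W
        where
          xv-indep = ∷-LinIndep {a = x ∷ v ∷ []} (LinIndep-line v≢0) x∉⟨v⟩

  -- Four vectors of the 3-space Y satisfy a relation; its Z-part is a common vector of Z and W.
  planes-in-3-space-meet : ∀ {Y Z W : Pred V c} → HasDim 3 Y → HasDim 2 Z → HasDim 2 W → Z ⊆ₛ Y → W ⊆ₛ Y → Meet Z W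
  planes-in-3-space-meet {Y} {Z} {W} dY dZ@(z , iz , _) dW@(w , iw , _) Z⊆Y W⊆Y =
    meet-of-relation (dependent four (proj₁ dY) four⊆Y)
    where
      four : Fin 4 → V
      four = z fzero ∷ z (fsuc fzero) ∷ w fzero ∷ w (fsuc fzero) ∷ []

      four⊆Y : ∀ l → Span (proj₁ dY) (four l)
      four⊆Y fzero = ∈⇒Span dY (Z⊆Y _ (basis-∈ dZ fzero))
      four⊆Y (fsuc fzero) = ∈⇒Span dY (Z⊆Y _ (basis-∈ dZ (fsuc fzero)))
      four⊆Y (fsuc (fsuc fzero)) = ∈⇒Span dY (W⊆Y _ (basis-∈ dW fzero))
      four⊆Y (fsuc (fsuc (fsuc fzero))) = ∈⇒Span dY (W⊆Y _ (basis-∈ dW (fsuc fzero)))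

      meet-of-relation : Dependent four → Meet Z W
      meet-of-relation (γ , (l , γl≢0) , γ4≡0) =
        v , Span⇒∈ dZ (γz , λ j → refl) , Span⇒∈ dW ((λ i → - γw i) , v≐-γw) , ¬≐0⇒Nonzero (γl≢0 ∘ all-zero l)
        where
          γz γw : Fin 2 → Carrier
          γz = γ fzero ∷ γ (fsuc fzero) ∷ []
          γw = γ (fsuc (fsuc fzero)) ∷ γ (fsuc (fsuc (fsuc fzero))) ∷ []

          v : V
          v = lincomb γz z

          v+γw≡0 : ∀ j → v j + lincomb γw w j ≡ 0#
          v+γw≡0 j = trans (solve 3 (λ A B C → (A :+ (B :+ con ℤ.0ℤ)) :+ C := A :+ (B :+ C)) refl _ _ _) (γ4≡0 j)

          v≐-γw : ∀ j → v j ≡ lincomb (λ i → - γw i) w j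
          v≐-γw j = trans (+-inverseˡ-unique _ _ (v+γw≡0 j)) (sym (lincomb-neg γw w j))

          γw-zero : (∀ j → v j ≡ 0#) → ∀ i → γw i ≡ 0#
          γw-zero v≐0 = iw γw λ j → begin
            lincomb γw w j        ≡⟨ sym (+-identityˡ _) ⟩
            0# + lincomb γw w j   ≡⟨ cong (_+ lincomb γw w j) (sym (v≐0 j)) ⟩
            v j + lincomb γw w j  ≡⟨ v+γw≡0 j ⟩
            0#                    ∎

          all-zero : ∀ l → (∀ j → v j ≡ 0#) → γ l ≡ 0#
          all-zero fzero v≐0 = iz γz v≐0 fzero
          all-zero (fsuc fzero) v≐0 = iz γz v≐0 (fsuc fzero)
          all-zero (fsuc (fsuc fzero)) v≐0 = γw-zero v≐0 fzero
          all-zero (fsuc (fsuc (fsuc fzero))) v≐0 = γw-zero v≐0 (fsuc fzero)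

  Tc-isClique : ∀ {Y : Pred V c} → HasDim 3 Y → IsClique (Tc Y)
  Tc-isClique dY = (λ _ → proj₂) , λ { Z W (Z⊆Y , dZ , _) (W⊆Y , dW , _) Z≉W →
    distinct-planes-meet-in-line dZ dW Z≉W (planes-in-3-space-meet dY dZ dW Z⊆Y W⊆Y) }

  module Maximality {Y : Pred V c} (dY : HasDim 3 Y) {u : V} (u≢0 : Nonzero u) {W₁ W₂ W₃ : Pred V c}
                    (W₁∈Tc : Tc Y W₁) (W₂∈Tc : Tc Y W₂) (W₃∈Tc : Tc Y W₃)
                    (W₁∩W₂⊆u : ∀ t → W₁ t → W₂ t → line u t) (u∉W₃ : ¬ W₃ u) where

    module _ {𝒦 : Family} (𝒦-clique : IsClique 𝒦) (Tc⊆𝒦 : ∀ W → Tc Y W → 𝒦 W) {Z : Pred V c} (Z∈𝒦 : 𝒦 Z) where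
      private
        dZ : HasDim 2 Z
        dZ = proj₁ (proj₁ 𝒦-clique Z Z∈𝒦)

        z : Fin 2 → V
        z = proj₁ dZ

        Meet-of-≉ : ∀ {W} → Tc Y W → ¬ Z ≈ₛ W → Meet Z W
        Meet-of-≉ {W} W∈Tc Z≉W with b , ib , Z∩W⇔b ← proj₂ 𝒦-clique Z W Z∈𝒦 (Tc⊆𝒦 W W∈Tc) Z≉W =
          let b₀∈Z , b₀∈W = Equivalence.from (Z∩W⇔b (b fzero)) (Span-member b fzero)
          in b fzero , b₀∈Z , b₀∈W , LinIndep⇒Nonzero {a = b} ib fzero

        ⊆Y-or-Meet : ∀ {W} → Tc Y W → Z ⊆ₛ Y ⊎ Meet Z W
        ⊆Y-or-Meet {W} W∈Tc@(W⊆Y , (dW , _)) with ∈? dW (z fzero) | ∈? dW (z (fsuc fzero))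
        ... | yes z₀∈W | yes z₁∈W = inj₁ λ t t∈Z → W⊆Y t (plane-closed dW z₀∈W z₁∈W (∈⇒Span dZ t∈Z))
        ... | no z₀∉W | _ = inj₂ (Meet-of-≉ W∈Tc λ Z≈W → z₀∉W (Equivalence.to (Z≈W _) (basis-∈ dZ fzero)))
        ... | _ | no z₁∉W = inj₂ (Meet-of-≉ W∈Tc λ Z≈W → z₁∉W (Equivalence.to (Z≈W _) (basis-∈ dZ (fsuc fzero))))

        ⊆Y-of-LinIndep : ∀ {v w} → Z v → Z w → Y v → Y w → LinIndep (v ∷ w ∷ []) → Z ⊆ₛ Y
        ⊆Y-of-LinIndep v∈Z w∈Z v∈Y w∈Y i t t∈Z = plane-closed dY v∈Y w∈Y (plane-⊆-Span dZ i v∈Z w∈Z t t∈Z)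

        ⊆Y-via-u : Z u → Y u → Z ⊆ₛ Y ⊎ Meet Z W₃ → Z ⊆ₛ Y
        ⊆Y-via-u _ _ (inj₁ Z⊆Y) = Z⊆Y
        ⊆Y-via-u u∈Z u∈Y (inj₂ (v , v∈Z , v∈W₃ , v≢0)) with Span? (u ∷ []) v
        ... | yes v∈⟨u⟩ = contradiction (line-closed (proj₁ (proj₂ W₃∈Tc)) v∈W₃ (line-sym v≢0 v∈⟨u⟩)) u∉W₃
        ... | no v∉⟨u⟩ =
          ⊆Y-of-LinIndep v∈Z u∈Z (proj₁ W₃∈Tc v v∈W₃) u∈Y (∷-LinIndep {a = v ∷ u ∷ []} (LinIndep-line u≢0) v∉⟨u⟩)

        -- If the meets with W₁ and W₂ are proportional, they lie in W₁ ∩ W₂ = ⟨u⟩, so u ∈ Z.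
        ⊆Y-of-Meets : Meet Z W₁ → Meet Z W₂ → Z ⊆ₛ Y
        ⊆Y-of-Meets (v₁ , v₁∈Z , v₁∈W₁ , v₁≢0) (v₂ , v₂∈Z , v₂∈W₂ , v₂≢0) with Span? (v₁ ∷ []) v₂
        ... | no v₂∉⟨v₁⟩ = ⊆Y-of-LinIndep v₂∈Z v₁∈Z (proj₁ W₂∈Tc v₂ v₂∈W₂) v₁∈Y v₂v₁-indep
          where
            v₁∈Y = proj₁ W₁∈Tc v₁ v₁∈W₁
            v₂v₁-indep = ∷-LinIndep {a = v₂ ∷ v₁ ∷ []} (LinIndep-line v₁≢0) v₂∉⟨v₁⟩
        ... | yes v₂∈⟨v₁⟩ = ⊆Y-via-u (line-closed dZ v₁∈Z u∈⟨v₁⟩) (line-closed dY v₁∈Y u∈⟨v₁⟩) (⊆Y-or-Meet W₃∈Tc)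
          where
            v₁∈Y = proj₁ W₁∈Tc v₁ v₁∈W₁
            v₁∈W₂ = line-closed (proj₁ (proj₂ W₂∈Tc)) v₂∈W₂ (line-sym v₂≢0 v₂∈⟨v₁⟩)

            u∈⟨v₁⟩ : line v₁ u
            u∈⟨v₁⟩ = line-sym v₁≢0 (W₁∩W₂⊆u v₁ v₁∈W₁ v₁∈W₂)

      ⊆Y : Z ⊆ₛ Y
      ⊆Y with ⊆Y-or-Meet W₁∈Tc | ⊆Y-or-Meet W₂∈Tc
      ... | inj₁ Z⊆Y | _ = Z⊆Y
      ... | inj₂ _ | inj₁ Z⊆Y = Z⊆Y
      ... | inj₂ meet₁ | inj₂ meet₂ = ⊆Y-of-Meets meet₁ meet₂

    Tc-isMaximalClique : IsMaximalClique (Tc Y)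
    Tc-isMaximalClique = Tc-isClique dY , λ 𝒦 𝒦-clique Tc⊆𝒦 Z Z∈𝒦 → ⊆Y 𝒦-clique Tc⊆𝒦 Z∈𝒦 , proj₁ 𝒦-clique Z Z∈𝒦

module Construction {c : Level} {q : ℕ} (F : FiniteField c q) (n : ℕ) where
  open FiniteField F
  open FieldProperties F
  open Geometry F n
  open LinearAlgebra F n
  open Cliques F n
  open ≡-Reasoning

  ¬InC⇒⊆C : ∀ {m} {X : Pred V c} → HasDim m X → ¬ InC m X → ∃ λ i → X ⊆ₛ C i
  ¬InC⇒⊆C dX X∉𝒞 with Fin.any? (λ i → Fin.all? (λ l → proj₁ dX l i ≟ 0#))
  ... | yes (i , basisᵢ≡0) = i , λ x x∈X → Span-vanishing i basisᵢ≡0 (∈⇒Span dX x∈X)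
  ... | no ¬∃ = contradiction (dX , λ i X⊆Cᵢ → ¬∃ (i , λ l → X⊆Cᵢ _ (basis-∈ dX l))) X∉𝒞

  e : Fin n → V
  e k = updateAt (λ _ → 0#) k (const 1#)

  e-same : ∀ k → e k k ≡ 1#
  e-same k = updateAt-updates k (λ _ → 0#)

  e-other : ∀ {k j} → j ≢ k → e k j ≡ 0#
  e-other {k} {j} j≢k = updateAt-minimal j k (λ _ → 0#) j≢k

  e-LinIndep : ∀ {m} (f : Fin m → Fin n) → Injective _≡_ _≡_ f → LinIndep (e ∘ f)
  e-LinIndep {zero} f f-inj = λ _ _ ()
  e-LinIndep {suc m} f f-inj =
    ∷-LinIndep-at {a = e ∘ f} (f fzero) (e-LinIndep (f ∘ fsuc) (Fin.suc-injective ∘ f-inj))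
      (λ l → e-other (Fin.0≢1+n ∘ f-inj)) (1≢0 ∘ trans (sym (e-same (f fzero))))

  ∃-e-∉ : ∀ {m} {X : Pred V c} → HasDim m X → (f : Fin (suc m) → Fin n) → Injective _≡_ _≡_ f →
          ∃ λ l → ¬ X (e (f l))
  ∃-e-∉ {m} dX f f-inj = Fin.¬∀⟶∃¬ (suc m) _ (λ l → ∈? dX (e (f l))) λ all∈X →
    ¬LinIndep-in-Span {a = e ∘ f} (∈⇒Span dX ∘ all∈X) (e-LinIndep f f-inj)

  plane-basis-vanishing-at : ∀ {X : Pred V c} → HasDim 2 X → ∀ k →
                             Σ V λ x → Σ V λ r → X x × X r × x k ≡ 0# × LinIndep (r ∷ x ∷ [])
  plane-basis-vanishing-at dX@(b , b-indep , _) k with b fzero k ≟ 0#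
  ... | yes b₀ₖ≡0 =
    b fzero , b (fsuc fzero) , basis-∈ dX fzero , basis-∈ dX (fsuc fzero) , b₀ₖ≡0 , LinIndep-swap b-indep
  ... | no b₀ₖ≢0 = x , b fzero , Span⇒∈ dX (δ , λ j → refl) , basis-∈ dX fzero , xₖ≡0 ,
                   ∷-LinIndep-at {a = b fzero ∷ x ∷ []} k (LinIndep-line x≢0) (λ { fzero → xₖ≡0 }) b₀ₖ≢0
    where
      δ : Fin 2 → Carrier
      δ = - (b (fsuc fzero) k * b fzero k ⁻¹) ∷ 1# ∷ []

      x : V
      x = lincomb δ b

      xₖ≡0 : x k ≡ 0#
      xₖ≡0 = begin
        - (b₁ₖ * b₀ₖ ⁻¹) * b₀ₖ + (1# * b₁ₖ + 0#)
          ≡⟨ solve 3 (λ b₀ₖ b₁ₖ b₀ₖ⁻¹ → :- (b₁ₖ :* b₀ₖ⁻¹) :* b₀ₖ :+ (con ℤ.1ℤ :* b₁ₖ :+ con ℤ.0ℤ)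
                                       := b₁ₖ :* (con ℤ.1ℤ :- b₀ₖ :* b₀ₖ⁻¹)) refl b₀ₖ b₁ₖ (b₀ₖ ⁻¹) ⟩
        b₁ₖ * (1# + - (b₀ₖ * b₀ₖ ⁻¹))
          ≡⟨ cong (λ s → b₁ₖ * (1# + - s)) (inverseʳ b₀ₖ b₀ₖ≢0) ⟩
        b₁ₖ * (1# + - 1#)
          ≡⟨ trans (cong (b₁ₖ *_) (-‿inverseʳ 1#)) (zeroʳ b₁ₖ) ⟩
        0#
          ∎
        where
          b₀ₖ = b fzero k
          b₁ₖ = b (fsuc fzero) k

      x≢0 : Nonzero x
      x≢0 = ¬≐0⇒Nonzero λ x≐0 → 1≢0 (b-indep δ x≐0 (fsuc fzero))

  NowhereZero : V → Set c
  NowhereZero v = ∀ j → v j ≢ 0#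

  module Extension {X : Pred V c} {i : Fin n} (X⊆Cᵢ : X ⊆ₛ C i) {r x : V} (r∈X : X r) (x∈X : X x)
                   (rx-indep : LinIndep (r ∷ x ∷ [])) (X⇔ : ∀ t → X t ⇔ Span (r ∷ x ∷ []) t)
                   {u : V} (u≠0 : NowhereZero u) (u+x≠0 : NowhereZero (u ⊕ x)) where

    Y : Pred V c
    Y = X +ₛ line u

    dY : HasDim 3 Y
    dY = (u ∷ r ∷ x ∷ []) ,
         ∷-LinIndep-at {a = u ∷ r ∷ x ∷ []} i rx-indep (pair-∈ {P = λ v → v i ≡ 0#} (X⊆Cᵢ r r∈X) (X⊆Cᵢ x x∈X)) (u≠0 i) ,
         +ₛ-line {b = r ∷ x ∷ []} X⇔ u

    private
      Y-indep : LinIndep (u ∷ r ∷ x ∷ [])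
      Y-indep = proj₁ (proj₂ dY)

      u∈Y : Y u
      u∈Y = basis-∈ dY fzero

      r≢0 : Nonzero r
      r≢0 = LinIndep⇒Nonzero {a = r ∷ x ∷ []} rx-indep fzero

      x≢0 : Nonzero x
      x≢0 = LinIndep⇒Nonzero {a = r ∷ x ∷ []} rx-indep (fsuc fzero)

    line-∈𝒞 : InC 1 (line u)
    line-∈𝒞 = ((u ∷ []) , LinIndep-line (i , u≠0 i) , λ _ → mk⇔ id id) ,
              λ j ⟨u⟩⊆Cⱼ → u≠0 j (⟨u⟩⊆Cⱼ u (Span-member (u ∷ []) fzero))

    Y-∈𝒞 : InC 3 Y
    Y-∈𝒞 = dY , λ j Y⊆Cⱼ → u≠0 j (Y⊆Cⱼ u u∈Y)

    plane-∈Tc : ∀ {v w} → Y v → Y w → NowhereZero v → Nonzero w → w i ≡ 0# → Tc Y (Span (v ∷ w ∷ []))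
    plane-∈Tc {v} {w} v∈Y w∈Y v≠0 w≢0 wᵢ≡0 =
      (λ t → plane-closed dY v∈Y w∈Y) ,
      ((v ∷ w ∷ []) , ∷-LinIndep-at {a = v ∷ w ∷ []} i (LinIndep-line w≢0) (λ { fzero → wᵢ≡0 }) (v≠0 i) ,
                      λ _ → mk⇔ id id) ,
      λ j P⊆Cⱼ → v≠0 j (P⊆Cⱼ v (Span-member (v ∷ w ∷ []) fzero))

    W₁ W₂ W₃ : Pred V c
    W₁ = Span (u ∷ x ∷ [])
    W₂ = Span (u ∷ r ∷ [])
    W₃ = Span ((u ⊕ x) ∷ r ∷ [])

    W₁∩W₂⊆⟨u⟩ : ∀ t → W₁ t → W₂ t → line u t
    W₁∩W₂⊆⟨u⟩ t (α , t≐α) (β , t≐β) = (α fzero ∷ []) , λ j →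
      trans (t≐α j) (cong (α fzero * u j +_) (trans (cong (λ s → s * x j + 0#) α₁≡0) (trans (+-identityʳ _) (zeroˡ (x j)))))
      where
        γ : Fin 3 → Carrier
        γ = α fzero + - β fzero ∷ - β (fsuc fzero) ∷ α (fsuc fzero) ∷ []

        relation : ∀ j → lincomb γ (u ∷ r ∷ x ∷ []) j ≡ 0#
        relation j = trans
          (solve 7 (λ a₀ a₁ b₀ b₁ u r x →
              (a₀ :- b₀) :* u :+ (:- b₁ :* r :+ (a₁ :* x :+ con ℤ.0ℤ))
              := (a₀ :* u :+ (a₁ :* x :+ con ℤ.0ℤ)) :- (b₀ :* u :+ (b₁ :* r :+ con ℤ.0ℤ))) refl
            (α fzero) (α (fsuc fzero)) (β fzero) (β (fsuc fzero)) (u j) (r j) (x j))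
          (x≈y⇒x∙y⁻¹≈ε (trans (sym (t≐α j)) (t≐β j)))

        α₁≡0 : α (fsuc fzero) ≡ 0#
        α₁≡0 = Y-indep γ relation (fsuc (fsuc fzero))

    u∉W₃ : ¬ W₃ u
    u∉W₃ (α , u≐α) = 0≢1 (trans (sym α₀≡0) α₀≡1)
      where
        γ : Fin 3 → Carrier
        γ = α fzero + - 1# ∷ α (fsuc fzero) ∷ α fzero ∷ []

        relation : ∀ j → lincomb γ (u ∷ r ∷ x ∷ []) j ≡ 0#
        relation j = trans
          (solve 5 (λ a₀ a₁ u r x →
              (a₀ :- con ℤ.1ℤ) :* u :+ (a₁ :* r :+ (a₀ :* x :+ con ℤ.0ℤ))
              := (a₀ :* (u :+ x) :+ (a₁ :* r :+ con ℤ.0ℤ)) :- u) refl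
            (α fzero) (α (fsuc fzero)) (u j) (r j) (x j))
          (x≈y⇒x∙y⁻¹≈ε (sym (u≐α j)))

        α₀≡0 : α fzero ≡ 0#
        α₀≡0 = Y-indep γ relation (fsuc (fsuc fzero))

        α₀≡1 : α fzero ≡ 1#
        α₀≡1 = x∙y⁻¹≈ε⇒x≈y _ _ (Y-indep γ relation fzero)

    Tc-isMaximalClique : IsMaximalClique (Tc Y)
    Tc-isMaximalClique = Maximality.Tc-isMaximalClique dY (i , u≠0 i)
      (plane-∈Tc u∈Y (basis-∈ dY (fsuc (fsuc fzero))) u≠0 x≢0 (X⊆Cᵢ x x∈X))
      (plane-∈Tc u∈Y (basis-∈ dY (fsuc fzero)) u≠0 r≢0 (X⊆Cᵢ r r∈X))
      (plane-∈Tc u+x∈Y (basis-∈ dY (fsuc fzero)) u+x≠0 r≢0 (X⊆Cᵢ r r∈X))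
      W₁∩W₂⊆⟨u⟩ u∉W₃
      where
        u+x∈Y : Y (u ⊕ x)
        u+x∈Y = plane-closed dY u∈Y (basis-∈ dY (fsuc (fsuc fzero))) ((1# ∷ 1# ∷ []) , λ j →
          solve 2 (λ u x → u :+ x := con ℤ.1ℤ :* u :+ (con ℤ.1ℤ :* x :+ con ℤ.0ℤ)) refl (u j) (x j))

  ∈-+ₛ-line : ∀ {m} {X : Pred V c} → HasDim m X → ∀ u → (X +ₛ line u) u
  ∈-+ₛ-line dX u = (λ _ → 0#) , u , zero-∈ dX , Span-member (u ∷ []) fzero , λ j → sym (+-identityˡ (u j))

  +ₛ-line-∩-C : ∀ {m} {X : Pred V c} (dX : HasDim m X) {i} → X ⊆ₛ C i → ∀ {u} → u i ≢ 0# →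
                ∀ {w} → (X +ₛ line u) w → w i ≡ 0# → X w
  +ₛ-line-∩-C {X = X} dX {i} X⊆Cᵢ {u} uᵢ≢0 {w} (y , z , y∈X , (g , z≐gu) , w≐y+z) wᵢ≡0 =
    ∈-resp dX y∈X λ j → sym (trans (w≐y+z j) (trans (cong (y j +_) (z≐0 j)) (+-identityʳ (y j))))
    where
      g₀uᵢ≡0 : g fzero * u i ≡ 0#
      g₀uᵢ≡0 = begin
        g fzero * u i       ≡⟨ sym (trans (z≐gu i) (+-identityʳ _)) ⟩
        z i                 ≡⟨ sym (+-identityˡ (z i)) ⟩
        0# + z i            ≡⟨ cong (_+ z i) (sym (X⊆Cᵢ y y∈X)) ⟩
        y i + z i           ≡⟨ sym (w≐y+z i) ⟩
        w i                 ≡⟨ wᵢ≡0 ⟩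
        0#                  ∎

      z≐0 : ∀ j → z j ≡ 0#
      z≐0 j = begin
        z j                 ≡⟨ trans (z≐gu j) (+-identityʳ _) ⟩
        g fzero * u j       ≡⟨ cong (_* u j) (*-cancel-≢0ʳ uᵢ≢0 g₀uᵢ≡0) ⟩
        0# * u j            ≡⟨ zeroˡ (u j) ⟩
        0#                  ∎

  extensions-differ : ∀ {m} {X : Pred V c} (dX : HasDim m X) {i} → X ⊆ₛ C i → ∀ {k} → k ≢ i → ¬ X (e k) →
                      ∀ {m′ u u′} → HasDim m′ (X +ₛ line u) → u i ≢ 0# → (∀ j → j ≢ k → u′ j ≡ u j) → u′ k ≢ u k →
                      ¬ (X +ₛ line u) ≈ₛ (X +ₛ line u′)
  extensions-differ {X = X} dX {i} X⊆Cᵢ {k} k≢i eₖ∉X {u = u} {u′} dY uᵢ≢0 u′≐u u′ₖ≢uₖ Y≈Y′ =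
    eₖ∉X (line-closed dX v∈X eₖ∈⟨v⟩)
    where
      v : V
      v j = u′ j + - u j

      v∈X : X v
      v∈X = +ₛ-line-∩-C dX X⊆Cᵢ uᵢ≢0
              (difference-∈ dY (Equivalence.from (Y≈Y′ u′) (∈-+ₛ-line dX u′)) (∈-+ₛ-line dX u))
              (x≈y⇒x∙y⁻¹≈ε (u′≐u i (k≢i ∘ sym)))

      vₖ≢0 : v k ≢ 0#
      vₖ≢0 = u′ₖ≢uₖ ∘ x∙y⁻¹≈ε⇒x≈y _ _

      eₖ∈⟨v⟩ : line v (e k)
      eₖ∈⟨v⟩ = (v k ⁻¹ ∷ []) , scaled
        where
          scaled : ∀ j → e k j ≡ v k ⁻¹ * v j + 0#
          scaled j with j Fin.≟ k
          ... | yes refl = begin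
            e k k                 ≡⟨ e-same k ⟩
            1#                    ≡⟨ sym (inverseʳ (v k) vₖ≢0) ⟩
            v k * v k ⁻¹          ≡⟨ *-comm _ _ ⟩
            v k ⁻¹ * v k          ≡⟨ sym (+-identityʳ _) ⟩
            v k ⁻¹ * v k + 0#     ∎
          ... | no j≢k = begin
            e k j                 ≡⟨ e-other j≢k ⟩
            0#                    ≡⟨ sym (zeroʳ _) ⟩
            v k ⁻¹ * 0#           ≡⟨ cong (v k ⁻¹ *_) (sym (x≈y⇒x∙y⁻¹≈ε (u′≐u j j≢k))) ⟩
            v k ⁻¹ * v j          ≡⟨ sym (+-identityʳ _) ⟩
            v k ⁻¹ * v j + 0#     ∎

  module TwoExtensions (3≤q : 3 ≤ q) {X : Pred V c} (dX : HasDim 2 X) {i k : Fin n} (X⊆Cᵢ : X ⊆ₛ C i) (k≢i : k ≢ i)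
                       (eₖ∉X : ¬ X (e k)) {x r : V} (x∈X : X x) (r∈X : X r) (xₖ≡0 : x k ≡ 0#)
                       (rx-indep : LinIndep (r ∷ x ∷ [])) where
    private
      u : V
      u j = proj₁ (∃-avoiding 3≤q 0# (- x j))

      u≠0 : NowhereZero u
      u≠0 j = proj₁ (proj₂ (∃-avoiding 3≤q 0# (- x j)))

      u+x≠0 : NowhereZero (u ⊕ x)
      u+x≠0 j = proj₂ (proj₂ (∃-avoiding 3≤q 0# (- x j))) ∘ +-inverseˡ-unique _ _

      t : Carrier
      t = proj₁ (∃-avoiding 3≤q 0# (u k))

      u′ : V
      u′ = updateAt u k (const t)

      u′ₖ≡t : u′ k ≡ t
      u′ₖ≡t = updateAt-updates k u

      u′≐u : ∀ j → j ≢ k → u′ j ≡ u j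
      u′≐u j = updateAt-minimal j k u

      u′ₖ≢uₖ : u′ k ≢ u k
      u′ₖ≢uₖ = proj₂ (proj₂ (∃-avoiding 3≤q 0# (u k))) ∘ trans (sym u′ₖ≡t)

      u′≠0 : NowhereZero u′
      u′≠0 j with j Fin.≟ k
      ... | yes refl = proj₁ (proj₂ (∃-avoiding 3≤q 0# (u k))) ∘ trans (sym u′ₖ≡t)
      ... | no j≢k = u≠0 j ∘ trans (sym (u′≐u j j≢k))

      u′+x≠0 : NowhereZero (u′ ⊕ x)
      u′+x≠0 j with j Fin.≟ k
      ... | yes refl = u′≠0 k ∘ trans (sym (trans (cong (u′ k +_) xₖ≡0) (+-identityʳ (u′ k))))
      ... | no j≢k = u+x≠0 j ∘ trans (sym (cong (_+ x j) (u′≐u j j≢k)))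

      X⇔ : ∀ t → X t ⇔ Span (r ∷ x ∷ []) t
      X⇔ = spanned-by-LinIndep dX {a = r ∷ x ∷ []} rx-indep (pair-∈ {P = X} r∈X x∈X)

      module E = Extension X⊆Cᵢ r∈X x∈X rx-indep X⇔ u≠0 u+x≠0
      module E′ = Extension X⊆Cᵢ r∈X x∈X rx-indep X⇔ u′≠0 u′+x≠0

    result : Σ (Pred V c) λ X₁ → Σ (Pred V c) λ X₂ →
             InC 1 X₁ × InC 1 X₂ × InC 3 (X +ₛ X₁) × InC 3 (X +ₛ X₂) × ¬ ((X +ₛ X₁) ≈ₛ (X +ₛ X₂)) ×
             IsMaximalClique (Tc (X +ₛ X₁)) × IsMaximalClique (Tc (X +ₛ X₂))
    result = line u , line u′ , E.line-∈𝒞 , E′.line-∈𝒞 , E.Y-∈𝒞 , E′.Y-∈𝒞 ,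
             extensions-differ dX X⊆Cᵢ k≢i eₖ∉X E.dY (u≠0 i) u′≐u u′ₖ≢uₖ ,
             E.Tc-isMaximalClique , E′.Tc-isMaximalClique

lemma4 : ∀ {c : Level} (q : ℕ) (F : FiniteField c q) → 3 ≤ q → (n : ℕ) → 4 ≤ n →
    let open Geometry F n in
    ∀ (X : Pred V c) → HasDim 2 X → ¬ InC 2 X →
    Σ (Pred V c) λ X₁ → Σ (Pred V c) λ X₂ →
      InC 1 X₁ × InC 1 X₂ ×
      InC 3 (X +ₛ X₁) × InC 3 (X +ₛ X₂) × ¬ ((X +ₛ X₁) ≈ₛ (X +ₛ X₂)) ×
      IsMaximalClique (Tc (X +ₛ X₁)) × IsMaximalClique (Tc (X +ₛ X₂))
lemma4 q F 3≤q (suc n₀) (s≤s 3≤n₀) X dX X∉𝒞 =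
  let i , X⊆Cᵢ = ¬InC⇒⊆C dX X∉𝒞
      f , f-injective , f≢i = injection-avoiding i 3≤n₀
      l , eₖ∉X = ∃-e-∉ dX f f-injective
      x , r , x∈X , r∈X , xₖ≡0 , rx-indep = plane-basis-vanishing-at dX (f l)
  in TwoExtensions.result 3≤q dX X⊆Cᵢ (f≢i l) eₖ∉X x∈X r∈X xₖ≡0 rx-indep
  where open Construction F (suc n₀)
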